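{- Let \(\mathbb{E}\) be the set of positive even integers and let \(M,N\subseteq\mathbb{E}\) with \(M\neq N\). Then \(\mathrm{Var}(\mathbf{D}_M)\neq\mathrm{Var}(\mathbf{D}_N)\).
   Context: For a set \(W\) with a binary relation \(R\), the complex algebra \(\mathsf{Cm}(\langle W;R\rangle)\) is the power set Boolean algebra of \(W\) with the operation \(\Diamond X=\{w\in W\mid w\,R\,x\text{ for some }x\in X\}\). For \(N\subseteq\mathbb{E}\), the frame \(\mathbb{F}_N=\langle W;R_N\rangle\): \(W\) consists of pairwise distinct elements \(a,b_1,b_2,b_3,c_1,c_2,d\), \(u_i\) (\(i\geqslant 1\)) and \(\ell_i\) (\(i\geqslant 0\)); \(R_N\) is the reflexive symmetric relation on \(W\) whose non-loop edges \(\{x,y\}\) are exactly: \(\{a,b_i\}\) for \(i\in\{1,2,3\}\); \(\{b_i,c_i\}\) for \(i\in\{1,2\}\); \(\{c_1,d\}\); \(\{\ell_0,\ell_1\}\); \(\{a,\ell_i\}\) for all \(i\geqslant 0\); \(\{\ell_i,u_i\}\) for all \(i\geqslant 1\); \(\{\ell_i,u_{i-1}\}\) for \(i\in\mathbb{E}\); \(\{\ell_i,u_{i+1}\}\) for \(i\in N\); \(\{\ell_{i+1},u_i\}\) for \(i\in\mathbb{E}\setminus N\). \(\mathbf{D}_N\) is the subalgebra of \(\mathsf{Cm}(\mathbb{F}_N)\) generated by \(\{d\}\). \(\mathrm{Var}(\mathbf{A})\) denotes the variety generated by \(\mathbf{A}\). -}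

module Defs where

open import Data.Nat using (ℕ; zero; suc; _+_)
open import Data.Product using (Σ; ∃; ∃-syntax; _×_; _,_)
open import Data.Sum using (_⊎_)
open import Relation.Nullary using (¬_)
open import Relation.Binary.PropositionalEquality using (_≡_)
open import Function.Bundles using (_⇔_)

PosEven : ℕ → Set
PosEven i = ∃[ k ] i ≡ suc k + suc k

record SubsetE : Set₁ where
  field
    mem : ℕ → Set
    ⊆E  : ∀ i → mem i → PosEven i
open SubsetE public

-- the points of the frame F_N.  'u₊ n' is u_{n+1} (so u_i, i ≥ 1),
-- 'ℓ n' is ℓ_n (n ≥ 0).
data W : Set where
  a b₁ b₂ b₃ c₁ c₂ d : W
  u₊ : ℕ → W
  ℓ  : ℕ → W

-- the listed non-loop edges, each in one orientation
data Edge (N : SubsetE) : W → W → Set where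
  ab₁ : Edge N a b₁
  ab₂ : Edge N a b₂
  ab₃ : Edge N a b₃
  bc₁ : Edge N b₁ c₁
  bc₂ : Edge N b₂ c₂
  cd  : Edge N c₁ d
  ℓ₀ℓ₁ : Edge N (ℓ 0) (ℓ 1)
  aℓ  : ∀ i → Edge N a (ℓ i)
  -- {ℓ_i , u_i}, i ≥ 1
  ℓu  : ∀ n → Edge N (ℓ (suc n)) (u₊ n)
  -- {ℓ_i , u_{i-1}}, i ∈ 𝔼   (i = m+2, u_{m+1} = u₊ m)
  ℓu⁻ : ∀ m → PosEven (suc (suc m)) → Edge N (ℓ (suc (suc m))) (u₊ m)
  -- {ℓ_i , u_{i+1}}, i ∈ N
  ℓu⁺ : ∀ i → mem N i → Edge N (ℓ i) (u₊ i)
  -- {ℓ_{i+1} , u_i}, i ∈ 𝔼 ∖ N   (i = m+1, u_i = u₊ m)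
  ℓ⁺u : ∀ m → PosEven (suc m) → ¬ mem N (suc m) → Edge N (ℓ (suc (suc m))) (u₊ m)

R : SubsetE → W → W → Set
R N x y = x ≡ y ⊎ Edge N x y ⊎ Edge N y x

Sub : Set₁
Sub = W → Set

∅ᶜ ⊤ᶜ : Sub
∅ᶜ _ = Data.Empty.⊥ where import Data.Empty
⊤ᶜ _ = Data.Unit.⊤ where import Data.Unit

_∩ᶜ_ _∪ᶜ_ : Sub → Sub → Sub
(X ∩ᶜ Y) w = X w × Y w
(X ∪ᶜ Y) w = X w ⊎ Y w

compᶜ : Sub → Sub
compᶜ X w = ¬ X w

◇ᶜ : SubsetE → Sub → Sub
◇ᶜ N X w = ∃[ x ] (R N w x × X x)

data Tm : Set where
  var : ℕ → Tm
  𝟎 𝟏 : Tm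
  _∧ₜ_ _∨ₜ_ : Tm → Tm → Tm
  ¬ₜ : Tm → Tm
  ◇ₜ : Tm → Tm

⟦_⟧ : Tm → SubsetE → (ℕ → Sub) → Sub
⟦ var i ⟧ N ρ = ρ i
⟦ 𝟎 ⟧ N ρ = ∅ᶜ
⟦ 𝟏 ⟧ N ρ = ⊤ᶜ
⟦ s ∧ₜ t ⟧ N ρ = ⟦ s ⟧ N ρ ∩ᶜ ⟦ t ⟧ N ρ
⟦ s ∨ₜ t ⟧ N ρ = ⟦ s ⟧ N ρ ∪ᶜ ⟦ t ⟧ N ρ
⟦ ¬ₜ t ⟧ N ρ = compᶜ (⟦ t ⟧ N ρ)
⟦ ◇ₜ t ⟧ N ρ = ◇ᶜ N (⟦ t ⟧ N ρ)

singleton-d : Sub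
singleton-d w = w ≡ d

-- elements of D_N = subalgebra generated by {d}: exactly the values
-- ⟦ t ⟧ N (λ _ → {d}) of terms t.  A valuation into D_N is given by
-- choosing, for every variable, a term representing its value.
valD : SubsetE → (ℕ → Tm) → (ℕ → Sub)
valD N σ i = ⟦ σ i ⟧ N (λ _ → singleton-d)

_≐_ : Sub → Sub → Set
X ≐ Y = ∀ w → X w ⇔ Y w

Valid : SubsetE → Tm → Tm → Set
Valid N s t = ∀ (σ : ℕ → Tm) → ⟦ s ⟧ N (valD N σ) ≐ ⟦ t ⟧ N (valD N σ)

-- Var(D_M) = Var(D_N), via Birkhoff: same equational theory
SameVariety : SubsetE → SubsetE → Set
SameVariety M N = ∀ s t → Valid M s t ⇔ Valid N s t

SameSubset : SubsetE → SubsetE → Set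
SameSubset M N = ∀ i → mem M i ⇔ mem N i

{-# OPTIONS --safe #-}
-- The frame has diameter 5, so ◇⁵ is the universal modality, and one-variable
-- terms evaluated at {d} can describe the whole frame: the spheres around d
-- and, inside the ℓ/u chain, the balls of every radius around ℓ₀.  Along the
-- chain, ℓ_{2k+3} is a dead end at distance start k + 2 from ℓ₀ exactly when
-- 2k+2 ∈ N, and start k only depends on N below 2k+2.  The term pinₜ is
-- nonempty only when the variable is {d}, so at the least 2k+2 where M and N
-- differ, pinₜ ∧ ¬ has-dead-endₜ (start k) ≈ 0 holds in one of D_M, D_N and
-- fails in the other.
module Submission where

open import Defs
open import Level using (0ℓ)
open import Axiom.ExcludedMiddle using (ExcludedMiddle)
open import Data.Bool using (if_then_else_)
open import Data.Empty using (⊥-elim)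
open import Data.Nat using (ℕ; zero; suc; _+_; _≤_; _<_; z≤n; s≤s; _≤?_)
open import Data.Nat.Induction using (<-rec)
open import Data.Nat.Properties
  using ( ≤-refl; ≤-reflexive; ≤-trans; ≤-antisym; ≤-pred; n≤1+n; m≤n⇒m≤1+n; m≤n⇒m<n∨m≡n
        ; m≤n+m; ≰⇒>; <⇒≱; <⇒≢; 1+n≰n; <-cmp; suc-injective; +-identityʳ; +-suc )
open import Data.Product using (∃; ∃-syntax; _×_; _,_; proj₁; proj₂)
open import Data.Sum using (_⊎_; inj₁; inj₂) renaming (map to ⊎-map)
open import Function.Base using (_∘_)
open import Function.Bundles using (_⇔_; mk⇔; Equivalence)
open import Function.Properties.Equivalence using () renaming (refl to ⇔-refl; sym to ⇔-sym)
open import Relation.Binary.Definitions using (tri<; tri≈; tri>)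
open import Relation.Binary.PropositionalEquality
  using (_≡_; _≢_; refl; sym; trans; cong; cong₂; subst; subst₂)
open import Relation.Nullary using (¬_; Dec; yes; no; does)
open import Relation.Nullary.Decidable using (from-yes; does-⇔)

2+n≰n : ∀ {n} → ¬ 2 + n ≤ n
2+n≰n le = 1+n≰n (≤-trans (n≤1+n _) le)

Adjacent : ℕ → ℕ → Set
Adjacent m n = m ≤ suc n × n ≤ suc m

adjacent-refl : ∀ n → Adjacent n n
adjacent-refl n = n≤1+n n , n≤1+n n

adjacent-suc : ∀ n → Adjacent n (suc n)
adjacent-suc n = m≤n⇒m≤1+n (n≤1+n n) , ≤-refl

adjacent-sym : ∀ {m n} → Adjacent m n → Adjacent n m
adjacent-sym (p , q) = q , p

dbl : ℕ → ℕ
dbl zero = zero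
dbl (suc k) = suc (suc (dbl k))

ev : ℕ → ℕ
ev k = suc (suc (dbl k))

data EvenOdd : ℕ → Set where
  even : ∀ k → EvenOdd (dbl k)
  odd : ∀ k → EvenOdd (suc (dbl k))

evenOdd : ∀ n → EvenOdd n
evenOdd zero = even zero
evenOdd (suc n) with evenOdd n
... | even k = odd k
... | odd k = even (suc k)

evenOdd-dbl : ∀ k → evenOdd (dbl k) ≡ even k
evenOdd-dbl zero = refl
evenOdd-dbl (suc k) rewrite evenOdd-dbl k = refl

evenOdd-suc-dbl : ∀ k → evenOdd (suc (dbl k)) ≡ odd k
evenOdd-suc-dbl k rewrite evenOdd-dbl k = refl

suc-dbl≡+ : ∀ k → suc (dbl k) ≡ k + suc k
suc-dbl≡+ zero = refl
suc-dbl≡+ (suc k) = cong suc (trans (cong suc (suc-dbl≡+ k)) (sym (+-suc k (suc k))))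

ev-posEven : ∀ k → PosEven (ev k)
ev-posEven k = k , cong suc (suc-dbl≡+ k)

posEven⇒ev : ∀ {n} → PosEven n → ∃[ k ] n ≡ ev k
posEven⇒ev (k , refl) = k , cong suc (sym (suc-dbl≡+ k))

dbl≢suc-dbl : ∀ k j → dbl k ≢ suc (dbl j)
dbl≢suc-dbl zero j ()
dbl≢suc-dbl (suc k) zero ()
dbl≢suc-dbl (suc k) (suc j) eq = dbl≢suc-dbl k j (suc-injective (suc-injective eq))

odd-not-posEven : ∀ k → ¬ PosEven (suc (dbl k))
odd-not-posEven k p with posEven⇒ev p
... | j , eq = dbl≢suc-dbl k j (suc-injective eq)

SameSubset-from-ev : ∀ {M N} → (∀ k → mem M (ev k) ⇔ mem N (ev k)) → SameSubset M N
SameSubset-from-ev {M} {N} agree i =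
  mk⇔ (along M {N} (Equivalence.to ∘ agree)) (along N {M} (Equivalence.from ∘ agree))
  where
  along : ∀ A {B} → (∀ k → mem A (ev k) → mem B (ev k)) → mem A i → mem B i
  along A f m with posEven⇒ev (⊆E A i m)
  ... | k , refl = f k m

R-sym : ∀ {N w z} → R N w z → R N z w
R-sym (inj₁ refl) = inj₁ refl
R-sym (inj₂ (inj₁ e)) = inj₂ (inj₂ e)
R-sym (inj₂ (inj₂ e)) = inj₂ (inj₁ e)

fwd : ∀ {N w z} → Edge N w z → R N w z
fwd e = inj₂ (inj₁ e)

bwd : ∀ {N w z} → Edge N z w → R N w z
bwd e = inj₂ (inj₂ e)

◇^ : SubsetE → ℕ → Sub → Sub
◇^ N zero X = X
◇^ N (suc k) X = ◇ᶜ N (◇^ N k X)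

Reach : SubsetE → ℕ → W → W → Set
Reach N k w z = ◇^ N k (_≡ z) w

module _ {N : SubsetE} where

  step : ∀ {X : Sub} {w z} → R N w z → X z → ◇ᶜ N X w
  step {z = z} r x = z , r , x

  ◇^-suc : ∀ k {X : Sub} {w} → ◇^ N k X w → ◇^ N (suc k) X w
  ◇^-suc k = step (inj₁ refl)

  ◇^-extensive : ∀ k {X : Sub} {w} → X w → ◇^ N k X w
  ◇^-extensive zero x = x
  ◇^-extensive (suc k) x = ◇^-suc k (◇^-extensive k x)

  ◇^-mono : ∀ k {X Y : Sub} → (∀ {v} → X v → Y v) → ∀ {w} → ◇^ N k X w → ◇^ N k Y w
  ◇^-mono zero f x = f x
  ◇^-mono (suc k) f (z , r , x) = z , r , ◇^-mono k f x

  ◇^-snoc : ∀ k {X : Sub} {w} → ◇^ N k (◇ᶜ N X) w → ◇^ N (suc k) X w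
  ◇^-snoc zero x = x
  ◇^-snoc (suc k) (z , r , x) = z , r , ◇^-snoc k x

  ◇^⇒Reach : ∀ k {X : Sub} {w} → ◇^ N k X w → ∃[ z ] X z × Reach N k w z
  ◇^⇒Reach zero {w = w} x = w , x , refl
  ◇^⇒Reach (suc k) (v , r , x) with ◇^⇒Reach k x
  ... | z , xz , reach = z , xz , v , r , reach

  Reach⇒◇^ : ∀ k {X : Sub} {w z} → Reach N k w z → X z → ◇^ N k X w
  Reach⇒◇^ k {X} reach x = ◇^-mono k (λ { refl → x }) reach

  Reach-sym : ∀ k {w z} → Reach N k w z → Reach N k z w
  Reach-sym zero refl = refl
  Reach-sym (suc k) (v , r , reach) =
    ◇^-snoc k (◇^-mono k (λ { refl → step (R-sym r) refl }) (Reach-sym k reach))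

  Reach-trans : ∀ j {k w v z} → Reach N j w v → Reach N k v z → Reach N (j + k) w z
  Reach-trans zero refl reach = reach
  Reach-trans (suc j) (x , r , reach) reach′ = x , r , Reach-trans j reach reach′

-- Depth: the distance to d

depth : W → ℕ
depth d = 0
depth c₁ = 1
depth b₁ = 2
depth a = 3
depth b₂ = 4
depth b₃ = 4
depth (ℓ _) = 4
depth c₂ = 5
depth (u₊ _) = 5

depth≤5 : ∀ w → depth w ≤ 5
depth≤5 d = from-yes (0 ≤? 5)
depth≤5 c₁ = from-yes (1 ≤? 5)
depth≤5 b₁ = from-yes (2 ≤? 5)
depth≤5 a = from-yes (3 ≤? 5)
depth≤5 b₂ = from-yes (4 ≤? 5)
depth≤5 b₃ = from-yes (4 ≤? 5)
depth≤5 (ℓ _) = from-yes (4 ≤? 5)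
depth≤5 c₂ = from-yes (5 ≤? 5)
depth≤5 (u₊ _) = from-yes (5 ≤? 5)

depth-adjacent : ∀ {N w z} → Edge N w z → Adjacent (depth w) (depth z)
depth-adjacent ab₁ = adjacent-sym (adjacent-suc 2)
depth-adjacent ab₂ = adjacent-suc 3
depth-adjacent ab₃ = adjacent-suc 3
depth-adjacent bc₁ = adjacent-sym (adjacent-suc 1)
depth-adjacent bc₂ = adjacent-suc 4
depth-adjacent cd = adjacent-sym (adjacent-suc 0)
depth-adjacent ℓ₀ℓ₁ = adjacent-refl 4
depth-adjacent (aℓ _) = adjacent-suc 3
depth-adjacent (ℓu _) = adjacent-suc 4
depth-adjacent (ℓu⁻ _ _) = adjacent-suc 4
depth-adjacent (ℓu⁺ _ _) = adjacent-suc 4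
depth-adjacent (ℓ⁺u _ _ _) = adjacent-suc 4

depth-lipschitz : ∀ {N w z} → R N w z → depth w ≤ suc (depth z)
depth-lipschitz (inj₁ refl) = n≤1+n _
depth-lipschitz (inj₂ (inj₁ e)) = proj₁ (depth-adjacent e)
depth-lipschitz (inj₂ (inj₂ e)) = proj₂ (depth-adjacent e)

depth-Reach : ∀ {N} k {w z} → Reach N k w z → depth w ≤ k + depth z
depth-Reach zero refl = ≤-refl
depth-Reach (suc k) (v , r , reach) = ≤-trans (depth-lipschitz r) (s≤s (depth-Reach k reach))

depth-descent : ∀ {N} w → w ≡ d ⊎ ∃[ z ] R N w z × suc (depth z) ≡ depth w
depth-descent d = inj₁ refl
depth-descent c₁ = inj₂ (d , fwd cd , refl)
depth-descent b₁ = inj₂ (c₁ , fwd bc₁ , refl)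
depth-descent a = inj₂ (b₁ , fwd ab₁ , refl)
depth-descent b₂ = inj₂ (a , bwd ab₂ , refl)
depth-descent b₃ = inj₂ (a , bwd ab₃ , refl)
depth-descent (ℓ n) = inj₂ (a , bwd (aℓ n) , refl)
depth-descent c₂ = inj₂ (b₂ , bwd bc₂ , refl)
depth-descent (u₊ n) = inj₂ (ℓ (suc n) , bwd (ℓu n) , refl)

depth≤⇒Reach-d : ∀ {N} k w → depth w ≤ k → Reach N k w d
depth≤⇒Reach-d {N} k w le with depth-descent {N} w
depth≤⇒Reach-d k w le | inj₁ refl = ◇^-extensive k refl
depth≤⇒Reach-d zero w le | inj₂ (z , _ , eq) with subst (_≤ 0) (sym eq) le
... | ()
depth≤⇒Reach-d (suc k) w le | inj₂ (z , r , eq) =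
  step r (depth≤⇒Reach-d k z (≤-pred (subst (_≤ suc k) (sym eq) le)))

◇^-singleton-d : ∀ {N} k {X : Sub} → X ≐ singleton-d → ∀ w → ◇^ N k X w ⇔ depth w ≤ k
◇^-singleton-d k {X} X≐d w = mk⇔ bound reach
  where
  bound : ◇^ _ k X w → depth w ≤ k
  bound x with ◇^⇒Reach k x
  ... | z , xz , reach with Equivalence.to (X≐d z) xz
  ... | refl = subst (depth w ≤_) (+-identityʳ k) (depth-Reach k reach)
  reach : depth w ≤ k → ◇^ _ k X w
  reach le = Reach⇒◇^ k (depth≤⇒Reach-d k w le) (Equivalence.from (X≐d d) refl)

toward-a : ∀ {N} w → w ≡ d ⊎ Reach N 2 w a
toward-a d = inj₁ refl
toward-a a = inj₂ (◇^-extensive 2 refl)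
toward-a b₁ = inj₂ (step (bwd ab₁) (◇^-extensive 1 refl))
toward-a b₂ = inj₂ (step (bwd ab₂) (◇^-extensive 1 refl))
toward-a b₃ = inj₂ (step (bwd ab₃) (◇^-extensive 1 refl))
toward-a c₁ = inj₂ (step (bwd bc₁) (step (bwd ab₁) refl))
toward-a c₂ = inj₂ (step (bwd bc₂) (step (bwd ab₂) refl))
toward-a (ℓ n) = inj₂ (step (bwd (aℓ n)) (◇^-extensive 1 refl))
toward-a (u₊ n) = inj₂ (step (bwd (ℓu n)) (step (bwd (aℓ (suc n))) refl))

depth≰4 : ∀ w → ¬ depth w ≤ 4 → depth w ≡ 5
depth≰4 w gt = ≤-antisym (depth≤5 w) (≰⇒> gt)

Far : W → W → Set
Far x y = (x ≡ d × depth y ≡ 5) ⊎ (depth x ≡ 5 × y ≡ d)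

within4-or-far : ∀ {N} x y → Reach N 4 y x ⊎ Far x y
within4-or-far x y with toward-a x | toward-a y
... | inj₂ x→a | inj₂ y→a = inj₁ (Reach-trans 2 {2} y→a (Reach-sym 2 x→a))
... | _ | inj₁ refl with depth x ≤? 4
...   | yes le = inj₁ (Reach-sym 4 (depth≤⇒Reach-d 4 x le))
...   | no gt = inj₂ (inj₂ (depth≰4 x gt , refl))
within4-or-far x y | inj₁ refl | inj₂ _ with depth y ≤? 4
...   | yes le = inj₁ (depth≤⇒Reach-d 4 y le)
...   | no gt = inj₂ (inj₁ (refl , depth≰4 y gt))

diameter≤5 : ∀ {N} w z → Reach N 5 w z
diameter≤5 w z with within4-or-far z w
... | inj₁ reach = ◇^-suc 4 reach
... | inj₂ (inj₁ (refl , _)) = depth≤⇒Reach-d 5 w (depth≤5 w)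
... | inj₂ (inj₂ (_ , refl)) = Reach-sym 5 (depth≤⇒Reach-d 5 z (depth≤5 z))

◇⁵-universal : ∀ {N} {X : Sub} z w → X z → ◇^ N 5 X w
◇⁵-universal z w x = Reach⇒◇^ 5 (diameter≤5 w z) x

depth≡3 : ∀ w → depth w ≡ 3 → w ≡ a
depth≡3 a _ = refl

neighbours-b₃ : ∀ {N z} → R N b₃ z → z ≡ b₃ ⊎ z ≡ a
neighbours-b₃ (inj₁ refl) = inj₁ refl
neighbours-b₃ (inj₂ (inj₂ ab₃)) = inj₂ refl

Reach2-b₃-depth≤4 : ∀ {N z} → Reach N 2 b₃ z → depth z ≤ 4
Reach2-b₃-depth≤4 (_ , rel , _ , rel′ , refl) with neighbours-b₃ rel
... | inj₂ refl = depth-lipschitz (R-sym rel′)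
... | inj₁ refl with neighbours-b₃ rel′
...   | inj₁ refl = ≤-refl
...   | inj₂ refl = n≤1+n 3

ℓ₀-neighbour-depth≤4 : ∀ {N z} → R N (ℓ 0) z → depth z ≤ 4
ℓ₀-neighbour-depth≤4 (inj₁ refl) = ≤-refl
ℓ₀-neighbour-depth≤4 (inj₂ (inj₁ ℓ₀ℓ₁)) = ≤-refl
ℓ₀-neighbour-depth≤4 {N} (inj₂ (inj₁ (ℓu⁺ .0 p))) with ⊆E N 0 p
... | _ , ()
ℓ₀-neighbour-depth≤4 (inj₂ (inj₂ (aℓ .0))) = n≤1+n 3

data Chain : W → Set where
  chain-ℓ : ∀ n → Chain (ℓ n)
  chain-u : ∀ n → Chain (u₊ n)

chain-depth : ∀ {w} → Chain w → depth w ≡ 4 ⊎ depth w ≡ 5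
chain-depth (chain-ℓ _) = inj₁ refl
chain-depth (chain-u _) = inj₂ refl

edge-from-chain : ∀ {N w z} → Edge N z w → Chain z → Chain w
edge-from-chain ℓ₀ℓ₁ _ = chain-ℓ 1
edge-from-chain (ℓu n) _ = chain-u n
edge-from-chain (ℓu⁻ m _) _ = chain-u m
edge-from-chain (ℓu⁺ i _) _ = chain-u i
edge-from-chain (ℓ⁺u m _ _) _ = chain-u m

edge-to-chain : ∀ {N w z} → Edge N w z → Chain z → Chain w ⊎ w ≡ a
edge-to-chain ℓ₀ℓ₁ _ = inj₁ (chain-ℓ 0)
edge-to-chain (aℓ _) _ = inj₂ refl
edge-to-chain (ℓu n) _ = inj₁ (chain-ℓ (suc n))
edge-to-chain (ℓu⁻ m _) _ = inj₁ (chain-ℓ (suc (suc m)))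
edge-to-chain (ℓu⁺ i _) _ = inj₁ (chain-ℓ i)
edge-to-chain (ℓ⁺u m _ _) _ = inj₁ (chain-ℓ (suc (suc m)))

chain-neighbour : ∀ {N w z} → R N w z → Chain z → Chain w ⊎ w ≡ a
chain-neighbour (inj₁ refl) c = inj₁ c
chain-neighbour (inj₂ (inj₁ e)) c = edge-to-chain e c
chain-neighbour (inj₂ (inj₂ e)) c = inj₁ (edge-from-chain e c)

-- dist is the distance from ℓ₀ inside the chain.  Block k consists of ℓ_{2k+2}
-- (at distance start k), u_{2k+2}, ℓ_{2k+3} and u_{2k+3}; the chain reaches
-- u_{2k+3} from ℓ_{2k+2} directly when 2k+2 ∈ N and via u_{2k+2}, ℓ_{2k+3}
-- otherwise, whence detour k ∈ {1, 3}.
module ChainDistance (N : SubsetE) (mem? : ∀ i → Dec (mem N i)) where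

  detour : ℕ → ℕ
  detour k = if does (mem? (ev k)) then 1 else 3

  start : ℕ → ℕ
  start zero = 3
  start (suc k) = suc (detour k + start k)

  ℓ-dist u-dist : ∀ {n} → EvenOdd n → ℕ
  ℓ-dist (even k) = start k
  ℓ-dist (odd k) = 2 + start k
  u-dist (even k) = 1 + start k
  u-dist (odd k) = detour k + start k

  dist : W → ℕ
  dist (ℓ zero) = 0
  dist (ℓ (suc zero)) = 1
  dist (ℓ (suc (suc n))) = ℓ-dist (evenOdd n)
  dist (u₊ zero) = 2
  dist (u₊ (suc n)) = u-dist (evenOdd n)
  dist _ = 0  -- junk off the chain

  dist-ℓ-even : ∀ k → dist (ℓ (ev k)) ≡ start k
  dist-ℓ-even k rewrite evenOdd-dbl k = refl

  dist-ℓ-odd : ∀ k → dist (ℓ (suc (ev k))) ≡ 2 + start k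
  dist-ℓ-odd k rewrite evenOdd-suc-dbl k = refl

  dist-u-even : ∀ k → dist (u₊ (suc (dbl k))) ≡ 1 + start k
  dist-u-even k rewrite evenOdd-dbl k = refl

  dist-u-odd : ∀ k → dist (u₊ (ev k)) ≡ detour k + start k
  dist-u-odd k rewrite evenOdd-suc-dbl k = refl

  dist-u-odd-∈ : ∀ {k} → mem N (ev k) → dist (u₊ (ev k)) ≡ 1 + start k
  dist-u-odd-∈ {k} m with mem? (ev k) | dist-u-odd k
  ... | yes _ | eq = eq
  ... | no ∉ | _ = ⊥-elim (∉ m)

  dist-u-odd-∉ : ∀ {k} → ¬ mem N (ev k) → dist (u₊ (ev k)) ≡ 3 + start k
  dist-u-odd-∉ {k} ∉ with mem? (ev k) | dist-u-odd k
  ... | yes m | _ = ⊥-elim (∉ m)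
  ... | no _ | eq = eq

  dist-adjacent : ∀ {w z} → Edge N w z → Chain w → Chain z → Adjacent (dist w) (dist z)
  dist-adjacent ℓ₀ℓ₁ _ _ = adjacent-suc 0
  dist-adjacent (ℓu zero) _ _ = adjacent-suc 1
  dist-adjacent (ℓu (suc n)) _ _ with evenOdd n
  ... | even k = adjacent-suc (start k)
  ... | odd k with mem? (ev k)
  ...   | yes _ = adjacent-sym (adjacent-suc (suc (start k)))
  ...   | no _ = adjacent-suc (2 + start k)
  dist-adjacent (ℓu⁻ m p) _ _ with posEven⇒ev p
  ... | zero , refl = adjacent-sym (adjacent-suc 2)
  ... | suc k , refl rewrite dist-ℓ-even (suc k) | dist-u-odd k =
    adjacent-sym (adjacent-suc (detour k + start k))
  dist-adjacent (ℓu⁺ i p) _ _ with posEven⇒ev (⊆E N i p)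
  ... | k , refl rewrite dist-ℓ-even k | dist-u-odd-∈ p = adjacent-suc (start k)
  dist-adjacent (ℓ⁺u m p _) _ _ with posEven⇒ev p
  ... | k , refl rewrite dist-ℓ-odd k | dist-u-even k = adjacent-sym (adjacent-suc (1 + start k))

  dist-lipschitz : ∀ {w z} → R N w z → Chain w → Chain z → dist w ≤ suc (dist z)
  dist-lipschitz (inj₁ refl) _ _ = n≤1+n _
  dist-lipschitz (inj₂ (inj₁ e)) cw cz = proj₁ (dist-adjacent e cw cz)
  dist-lipschitz (inj₂ (inj₂ e)) cw cz = proj₂ (dist-adjacent e cz cw)

  dist-descent : ∀ {w} → Chain w → w ≡ ℓ 0 ⊎ ∃[ z ] R N w z × Chain z × suc (dist z) ≡ dist w
  dist-descent (chain-ℓ zero) = inj₁ refl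
  dist-descent (chain-ℓ (suc zero)) = inj₂ (ℓ 0 , bwd ℓ₀ℓ₁ , chain-ℓ 0 , refl)
  dist-descent (chain-ℓ (suc (suc n))) with evenOdd n
  ... | even zero = inj₂ (u₊ 0 , fwd (ℓu⁻ 0 (ev-posEven 0)) , chain-u 0 , refl)
  ... | even (suc k) =
    inj₂ (u₊ (ev k) , fwd (ℓu⁻ (ev k) (ev-posEven (suc k))) , chain-u _ , cong suc (dist-u-odd k))
  ... | odd k with mem? (ev k)
  ...   | yes m = inj₂ (u₊ (ev k) , fwd (ℓu (ev k)) , chain-u _ , cong suc (dist-u-odd-∈ m))
  ...   | no ∉ =
    inj₂ (u₊ (suc (dbl k)) , fwd (ℓ⁺u (suc (dbl k)) (ev-posEven k) ∉) , chain-u _ , cong suc (dist-u-even k))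
  dist-descent (chain-u zero) = inj₂ (ℓ 1 , bwd (ℓu 0) , chain-ℓ 1 , refl)
  dist-descent (chain-u (suc n)) with evenOdd n
  ... | even k = inj₂ (ℓ (ev k) , bwd (ℓu (suc (dbl k))) , chain-ℓ _ , cong suc (dist-ℓ-even k))
  ... | odd k with mem? (ev k)
  ...   | yes m = inj₂ (ℓ (ev k) , bwd (ℓu⁺ (ev k) m) , chain-ℓ _ , cong suc (dist-ℓ-even k))
  ...   | no _ = inj₂ (ℓ (suc (ev k)) , bwd (ℓu (ev k)) , chain-ℓ _ , cong suc (dist-ℓ-odd k))

  dist≤0 : ∀ {w} → Chain w → dist w ≤ 0 → w ≡ ℓ 0
  dist≤0 c le with dist-descent c
  ... | inj₁ eq = eq
  ... | inj₂ (_ , _ , _ , eq) with subst (_≤ 0) (sym eq) le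
  ...   | ()

  start-step : ∀ k → 2 + start k ≤ start (suc k)
  start-step k with mem? (ev k)
  ... | yes _ = ≤-refl
  ... | no _ = m≤n⇒m≤1+n (n≤1+n _)

  start-mono : ∀ {j k} → j ≤ k → start j ≤ start k
  start-mono {k = zero} z≤n = ≤-refl
  start-mono {j} {suc k} le with m≤n⇒m<n∨m≡n le
  ... | inj₂ refl = ≤-refl
  ... | inj₁ (s≤s j≤k) = ≤-trans (start-mono j≤k) (≤-trans (m≤n+m (start k) 2) (start-step k))

  start-strict : ∀ {j k} → j < k → 2 + start j ≤ start k
  start-strict {j} j<k = ≤-trans (start-step j) (start-mono j<k)

  start≥3 : ∀ k → 3 ≤ start k
  start≥3 k = start-mono {zero} z≤n

  start-injective : ∀ {j k} → start j ≡ start k → j ≡ k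
  start-injective {j} {k} eq with <-cmp j k
  ... | tri< j<k _ _ = ⊥-elim (2+n≰n (subst (λ s → 2 + s ≤ start k) eq (start-strict j<k)))
  ... | tri≈ _ j≡k _ = j≡k
  ... | tri> _ _ k<j = ⊥-elim (2+n≰n (subst (λ s → 2 + start k ≤ s) eq (start-strict k<j)))

  start-gap : ∀ {j k} → start k < start j → start (suc k) ≤ start j
  start-gap {j} {k} lt with j ≤? k
  ... | yes j≤k = ⊥-elim (<⇒≱ lt (start-mono j≤k))
  ... | no j≰k = start-mono (≰⇒> j≰k)

  start-sparse : ∀ j k → start j ≢ suc (start k)
  start-sparse j k eq =
    1+n≰n (subst (2 + start k ≤_) eq (≤-trans (start-step k) (start-gap (≤-reflexive (sym eq)))))

  start-suc-∉ : ∀ {k} → ¬ mem N (ev k) → start (suc k) ≡ 4 + start k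
  start-suc-∉ {k} ∉ with mem? (ev k)
  ... | yes m = ⊥-elim (∉ m)
  ... | no _ = refl

  start-skip : ∀ {j k} → ¬ mem N (ev k) → start j ≢ 2 + start k
  start-skip {j} {k} ∉ eq = 2+n≰n (subst₂ _≤_ (start-suc-∉ ∉) eq (start-gap lt))
    where
    lt : start k < start j
    lt = ≤-trans (n≤1+n _) (≤-reflexive (sym eq))

  dist-unique : ∀ {k w} → ¬ mem N (ev k) → Chain w → dist w ≡ 2 + start k → w ≡ ℓ (suc (ev k))
  dist-unique ∉ (chain-ℓ (suc (suc n))) eq with evenOdd n
  ... | even j = ⊥-elim (start-skip ∉ eq)
  ... | odd j = cong (λ i → ℓ (suc (ev i))) (start-injective (suc-injective (suc-injective eq)))
  dist-unique {k} _ (chain-u zero) eq with subst (3 ≤_) (sym (suc-injective (suc-injective eq))) (start≥3 k)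
  ... | ()
  dist-unique {k} _ (chain-u (suc n)) eq with evenOdd n
  ... | even j = ⊥-elim (start-sparse j k (suc-injective eq))
  ... | odd j with mem? (ev j)
  ...   | yes _ = ⊥-elim (start-sparse j k (suc-injective eq))
  ...   | no _ = ⊥-elim (start-sparse k j (sym (suc-injective (suc-injective eq))))

  DeadEnd : ℕ → W → Set
  DeadEnd r v = Chain v × dist v ≡ 2 + r × (∀ {z} → R N v z → Chain z → dist z ≢ 3 + r)

  ℓ-odd-dead-end : ∀ {k} → mem N (ev k) → DeadEnd (start k) (ℓ (suc (ev k)))
  ℓ-odd-dead-end {k} m = chain-ℓ _ , dist-ℓ-odd k , no-exit
    where
    no-exit : ∀ {z} → R N (ℓ (suc (ev k))) z → Chain z → dist z ≢ 3 + start k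
    no-exit (inj₁ refl) _ eq = <⇒≢ ≤-refl (trans (sym (dist-ℓ-odd k)) eq)
    no-exit (inj₂ (inj₁ (ℓu _))) _ eq = <⇒≢ (n≤1+n _) (trans (sym (dist-u-odd-∈ m)) eq)
    no-exit (inj₂ (inj₁ (ℓu⁻ _ p))) = ⊥-elim (odd-not-posEven (suc k) p)
    no-exit (inj₂ (inj₁ (ℓu⁺ _ p))) = ⊥-elim (odd-not-posEven (suc k) (⊆E N _ p))
    no-exit (inj₂ (inj₁ (ℓ⁺u _ _ ∉))) = ⊥-elim (∉ m)
    no-exit (inj₂ (inj₂ (aℓ _))) ()

  no-dead-end : ∀ {k v} → ¬ mem N (ev k) → ¬ DeadEnd (start k) v
  no-dead-end {k} ∉ (c , eq , no-exit) with dist-unique ∉ c eq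
  ... | refl = no-exit (fwd (ℓu (ev k))) (chain-u _) (dist-u-odd-∉ ∉)

start-agree : ∀ {A B} (a? : ∀ i → Dec (mem A i)) (b? : ∀ i → Dec (mem B i)) k →
              (∀ {j} → j < k → mem A (ev j) ⇔ mem B (ev j)) →
              ChainDistance.start A a? k ≡ ChainDistance.start B b? k
start-agree a? b? zero _ = refl
start-agree a? b? (suc k) agree =
  cong₂ (λ b s → suc ((if b then 1 else 3) + s))
        (does-⇔ (agree ≤-refl) (a? (ev k)) (b? (ev k)))
        (start-agree a? b? k (λ j<k → agree (m≤n⇒m≤1+n j<k)))

-- Terms and their meaning at the generator {d}

x₀ : Tm
x₀ = var 0

◇ₜ^ : ℕ → Tm → Tm
◇ₜ^ zero t = t
◇ₜ^ (suc k) t = ◇ₜ (◇ₜ^ k t)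

⟦◇ₜ^⟧ : ∀ k t N ρ → ⟦ ◇ₜ^ k t ⟧ N ρ ≡ ◇^ N k (⟦ t ⟧ N ρ)
⟦◇ₜ^⟧ zero t N ρ = refl
⟦◇ₜ^⟧ (suc k) t N ρ = cong (◇ᶜ N) (⟦◇ₜ^⟧ k t N ρ)

sphereₜ : ℕ → Tm
sphereₜ k = ◇ₜ^ (suc k) x₀ ∧ₜ ¬ₜ (◇ₜ^ k x₀)

dead-endsₜ : (ℕ → Tm) → ℕ → Tm
dead-endsₜ layer k = layer k ∧ₜ ¬ₜ (◇ₜ (layer (suc k)))

seedₜ : Tm
seedₜ = dead-endsₜ sphereₜ 3

ballₜ : ℕ → Tm
ballₜ zero = seedₜ
ballₜ (suc r) = ballₜ r ∨ₜ (◇ₜ (ballₜ r) ∧ₜ (sphereₜ 3 ∨ₜ sphereₜ 4))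

shellₜ : ℕ → Tm
shellₜ s = ballₜ (suc s) ∧ₜ ¬ₜ (ballₜ s)

somewhereₜ : Tm → Tm
somewhereₜ = ◇ₜ^ 5

has-dead-endₜ : ℕ → Tm
has-dead-endₜ r = somewhereₜ (dead-endsₜ shellₜ (suc r))

module DepthSemantics {N : SubsetE} {ρ : ℕ → Sub} (x≐d : ρ 0 ≐ singleton-d) where

  within⇔ : ∀ k w → ⟦ ◇ₜ^ k x₀ ⟧ N ρ w ⇔ depth w ≤ k
  within⇔ k w rewrite ⟦◇ₜ^⟧ k x₀ N ρ = ◇^-singleton-d k x≐d w

  sphere⇔ : ∀ k w → ⟦ sphereₜ k ⟧ N ρ w ⇔ depth w ≡ suc k
  sphere⇔ k w = mk⇔ to from
    where
    to : ⟦ sphereₜ k ⟧ N ρ w → depth w ≡ suc k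
    to (inside , not-inside) =
      ≤-antisym (Equivalence.to (within⇔ (suc k) w) inside)
                (≰⇒> (λ le → not-inside (Equivalence.from (within⇔ k w) le)))
    from : depth w ≡ suc k → ⟦ sphereₜ k ⟧ N ρ w
    from eq = Equivalence.from (within⇔ (suc k) w) (≤-reflexive eq) ,
              λ inside → 1+n≰n (subst (_≤ k) eq (Equivalence.to (within⇔ k w) inside))

module ChainSemantics (N : SubsetE) (mem? : ∀ i → Dec (mem N i))
                      {ρ : ℕ → Sub} (x≐d : ρ 0 ≐ singleton-d) where
  open ChainDistance N mem?
  open DepthSemantics {N} {ρ} x≐d
  open Equivalence using (to; from)

  -- b₃ is the other dead end of the depth-4 sphere; its only other neighbour a
  -- is off the ring of depths 4 and 5, so the balls never grow out of it.
  InBall : ℕ → W → Set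
  InBall r w = w ≡ b₃ ⊎ (Chain w × dist w ≤ r)

  seed⇔ : ∀ w → ⟦ seedₜ ⟧ N ρ w ⇔ InBall 0 w
  seed⇔ w = mk⇔ (λ (s₄ , no₅) → seed⇒ w (to (sphere⇔ 3 w) s₄) no₅) seed⇐
    where
    no-sphere₅ : ∀ {v} → (∀ {z} → R N v z → depth z ≤ 4) → ¬ ◇ᶜ N (⟦ sphereₜ 4 ⟧ N ρ) v
    no-sphere₅ near (z , rel , s₅) = <⇒≢ (s≤s (near rel)) (to (sphere⇔ 4 z) s₅)
    seed⇒ : ∀ w → depth w ≡ 4 → ¬ ◇ᶜ N (⟦ sphereₜ 4 ⟧ N ρ) w → InBall 0 w
    seed⇒ b₂ _ no₅ = ⊥-elim (no₅ (step (fwd bc₂) (from (sphere⇔ 4 c₂) refl)))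
    seed⇒ b₃ _ _ = inj₁ refl
    seed⇒ (ℓ zero) _ _ = inj₂ (chain-ℓ 0 , z≤n)
    seed⇒ (ℓ (suc n)) _ no₅ = ⊥-elim (no₅ (step (fwd (ℓu n)) (from (sphere⇔ 4 (u₊ n)) refl)))
    b₃-neighbour-depth≤4 : ∀ {z} → R N b₃ z → depth z ≤ 4
    b₃-neighbour-depth≤4 rel with neighbours-b₃ rel
    ... | inj₁ refl = ≤-refl
    ... | inj₂ refl = n≤1+n 3
    seed⇐ : InBall 0 w → ⟦ seedₜ ⟧ N ρ w
    seed⇐ (inj₁ refl) = from (sphere⇔ 3 b₃) refl , no-sphere₅ b₃-neighbour-depth≤4
    seed⇐ (inj₂ (c , le)) with dist≤0 c le
    ... | refl = from (sphere⇔ 3 (ℓ 0)) refl , no-sphere₅ ℓ₀-neighbour-depth≤4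

  ring⇔ : ∀ w → ⟦ sphereₜ 3 ∨ₜ sphereₜ 4 ⟧ N ρ w ⇔ (depth w ≡ 4 ⊎ depth w ≡ 5)
  ring⇔ w = mk⇔ (⊎-map (to (sphere⇔ 3 w)) (to (sphere⇔ 4 w)))
                (⊎-map (from (sphere⇔ 3 w)) (from (sphere⇔ 4 w)))

  a-off-ring : ¬ (depth a ≡ 4 ⊎ depth a ≡ 5)
  a-off-ring (inj₁ ())
  a-off-ring (inj₂ ())

  ball⇒ : ∀ r w → ⟦ ballₜ r ⟧ N ρ w → InBall r w
  ball⇒ zero w b = to (seed⇔ w) b
  ball⇒ (suc r) w (inj₁ b) with ball⇒ r w b
  ... | inj₁ eq = inj₁ eq
  ... | inj₂ (c , le) = inj₂ (c , m≤n⇒m≤1+n le)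
  ball⇒ (suc r) w (inj₂ ((z , rel , b) , ring)) = extend (ball⇒ r z b)
    where
    extend : InBall r z → InBall (suc r) w
    extend (inj₁ refl) with neighbours-b₃ (R-sym rel)
    ... | inj₁ refl = inj₁ refl
    ... | inj₂ refl = ⊥-elim (a-off-ring (to (ring⇔ a) ring))
    extend (inj₂ (cz , le)) with chain-neighbour rel cz
    ... | inj₁ cw = inj₂ (cw , ≤-trans (dist-lipschitz rel cw cz) (s≤s le))
    ... | inj₂ refl = ⊥-elim (a-off-ring (to (ring⇔ a) ring))

  ball⇐ : ∀ r w → InBall r w → ⟦ ballₜ r ⟧ N ρ w
  ball⇐ zero w inb = from (seed⇔ w) inb
  ball⇐ (suc r) w (inj₁ refl) = inj₁ (ball⇐ r w (inj₁ refl))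
  ball⇐ (suc r) w (inj₂ (c , le)) with m≤n⇒m<n∨m≡n le
  ... | inj₁ lt = inj₁ (ball⇐ r w (inj₂ (c , ≤-pred lt)))
  ... | inj₂ eq with dist-descent c
  ball⇐ (suc r) _ (inj₂ (_ , _)) | inj₂ () | inj₁ refl
  ...   | inj₂ (z , rel , cz , eq′) =
    inj₂ ((z , rel , ball⇐ r z (inj₂ (cz , ≤-reflexive (suc-injective (trans eq′ eq))))) ,
          from (ring⇔ w) (chain-depth c))

  shell⇔ : ∀ s w → ⟦ shellₜ s ⟧ N ρ w ⇔ (Chain w × dist w ≡ suc s)
  shell⇔ s w = mk⇔ shell⇒ shell⇐
    where
    shell⇒ : ⟦ shellₜ s ⟧ N ρ w → Chain w × dist w ≡ suc s
    shell⇒ (b , nb) with ball⇒ (suc s) w b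
    ... | inj₁ refl = ⊥-elim (nb (ball⇐ s b₃ (inj₁ refl)))
    ... | inj₂ (c , le) = c , ≤-antisym le (≰⇒> (λ le′ → nb (ball⇐ s w (inj₂ (c , le′)))))
    shell⇐ : Chain w × dist w ≡ suc s → ⟦ shellₜ s ⟧ N ρ w
    shell⇐ (c , eq) = ball⇐ (suc s) w (inj₂ (c , ≤-reflexive eq)) , outside c eq
      where
      outside : Chain w → dist w ≡ suc s → ¬ ⟦ ballₜ s ⟧ N ρ w
      outside c eq b with ball⇒ s w b
      outside () _ _ | inj₁ refl
      outside _ eq _ | inj₂ (_ , le) = 1+n≰n (subst (_≤ s) eq le)

  has-dead-end⇔ : ∀ r w → ⟦ has-dead-endₜ r ⟧ N ρ w ⇔ ∃ (DeadEnd r)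
  has-dead-end⇔ r w = mk⇔ found place
    where
    found : ⟦ has-dead-endₜ r ⟧ N ρ w → ∃ (DeadEnd r)
    found h with ◇^⇒Reach 5 h
    ... | v , (sh , no-exit) , _ with to (shell⇔ (suc r) v) sh
    ... | c , eq =
      v , c , eq , λ rel cz eqz → no-exit (step rel (from (shell⇔ (suc (suc r)) _) (cz , eqz)))
    place : ∃ (DeadEnd r) → ⟦ has-dead-endₜ r ⟧ N ρ w
    place (v , c , eq , no-exit) =
      ◇⁵-universal v w (from (shell⇔ (suc r) v) (c , eq) ,
                        λ (z , rel , sh) → let (cz , eqz) = to (shell⇔ (suc (suc r)) z) sh in no-exit rel cz eqz)

-- Pinning the variable to {d}

farₜ : Tm → Tm
farₜ t = ¬ₜ (◇ₜ^ 4 t)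

_⊕ₜ_ : Tm → Tm → Tm
s ⊕ₜ t = (s ∧ₜ ¬ₜ t) ∨ₜ (¬ₜ s ∧ₜ t)

probeₜ : Tm
probeₜ = dead-endsₜ sphereₜ 2

-- As ◇⁵ is universal, pinₜ is nonempty iff x ≠ ∅, some point is far from x,
-- x = far (far x) and probeₜ is empty.  The first three force x = {d} or x =
-- the depth-5 sphere {c₂, uᵢ}; the sphere makes probeₜ true at b₃.
pinₜ : Tm
pinₜ = ((somewhereₜ x₀ ∧ₜ somewhereₜ (farₜ x₀)) ∧ₜ ¬ₜ (somewhereₜ (x₀ ⊕ₜ farₜ (farₜ x₀))))
       ∧ₜ ¬ₜ (somewhereₜ probeₜ)

module Pin {N : SubsetE} {ρ : ℕ → Sub} where
  open Equivalence using (to; from)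

  X : Sub
  X = ρ 0

  probe-at-b₃ : (∀ z → X z ⇔ depth z ≡ 5) → ⟦ probeₜ ⟧ N ρ b₃
  probe-at-b₃ X≐S = (◇³b₃ , not-◇²) , no-sphere
    where
    c₂∈X : X c₂
    c₂∈X = from (X≐S c₂) refl
    ◇³a : ◇^ N 3 X a
    ◇³a = step (fwd ab₂) (step (fwd bc₂) (◇^-extensive 1 c₂∈X))
    ◇³b₃ : ◇^ N 3 X b₃
    ◇³b₃ = step (bwd ab₃) (step (fwd ab₂) (step (fwd bc₂) c₂∈X))
    not-◇² : ¬ ◇^ N 2 X b₃
    not-◇² h with ◇^⇒Reach 2 h
    ... | z , z∈X , reach = <⇒≢ (s≤s (Reach2-b₃-depth≤4 reach)) (to (X≐S z) z∈X)
    no-sphere : ¬ ◇ᶜ N (⟦ sphereₜ 3 ⟧ N ρ) b₃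
    no-sphere (z , rel , _ , not-◇³) with neighbours-b₃ rel
    ... | inj₁ refl = not-◇³ ◇³b₃
    ... | inj₂ refl = not-◇³ ◇³a

  X-is-d : ∀ {y} → X d → ¬ ◇^ N 4 X y → depth y ≡ 5 → X ≐ singleton-d
  X-is-d {y} d∈X far-y depth-y z = mk⇔ at-d (λ { refl → d∈X })
    where
    at-d : X z → z ≡ d
    at-d z∈X with within4-or-far z y
    ... | inj₁ reach = ⊥-elim (far-y (Reach⇒◇^ 4 reach z∈X))
    ... | inj₂ (inj₁ (z≡d , _)) = z≡d
    ... | inj₂ (inj₂ (_ , y≡d)) = ⊥-elim (<⇒≢ (s≤s z≤n) (trans (cong depth (sym y≡d)) depth-y))

  X-is-sphere₅ : ExcludedMiddle 0ℓ → ∀ {x w} → X x → depth x ≡ 5 → ¬ ◇^ N 4 X d →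
                ¬ ⟦ somewhereₜ (x₀ ⊕ₜ farₜ (farₜ x₀)) ⟧ N ρ w → ∀ z → X z ⇔ depth z ≡ 5
  X-is-sphere₅ em {x} {w} x∈X depth-x far-d no-xor z = mk⇔ far-from-d in-X
    where
    far-from-d : X z → depth z ≡ 5
    far-from-d z∈X = depth≰4 z (λ le → far-d (Reach⇒◇^ 4 (Reach-sym 4 (depth≤⇒Reach-d 4 z le)) z∈X))
    only-d-far : ∀ {y} → ¬ ◇^ N 4 X y → y ≡ d
    only-d-far {y} far-y with within4-or-far x y
    ... | inj₁ reach = ⊥-elim (far-y (Reach⇒◇^ 4 reach x∈X))
    ... | inj₂ (inj₁ (x≡d , _)) = ⊥-elim (<⇒≢ (s≤s z≤n) (trans (cong depth (sym x≡d)) depth-x))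
    ... | inj₂ (inj₂ (_ , y≡d)) = y≡d
    in-X : depth z ≡ 5 → X z
    in-X depth-z with em {X z}
    ... | yes z∈X = z∈X
    ... | no ¬z∈X = ⊥-elim (no-xor (◇⁵-universal z w (inj₂ (¬z∈X , not-near-far))))
      where
      not-near-far : ¬ ◇^ N 4 (⟦ farₜ x₀ ⟧ N ρ) z
      not-near-far h with ◇^⇒Reach 4 h
      ... | y , far-y , reach with only-d-far far-y
      ... | refl = <⇒≢ (s≤s (depth-Reach 4 reach)) depth-z

  pin : ExcludedMiddle 0ℓ → ∀ {w} → ⟦ pinₜ ⟧ N ρ w → X ≐ singleton-d
  pin em (((◇x , ◇far) , no-xor) , no-probe) with ◇^⇒Reach 5 ◇x | ◇^⇒Reach 5 ◇far
  ... | x , x∈X , _ | y , far-y , _ with within4-or-far x y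
  ...   | inj₁ reach = ⊥-elim (far-y (Reach⇒◇^ 4 reach x∈X))
  ...   | inj₂ (inj₁ (refl , depth-y)) = X-is-d x∈X far-y depth-y
  ...   | inj₂ (inj₂ (depth-x , refl)) =
    ⊥-elim (no-probe (◇⁵-universal b₃ _ (probe-at-b₃ (X-is-sphere₅ em x∈X depth-x far-y no-xor))))

  pin-holds : X ≐ singleton-d → ∀ w → ⟦ pinₜ ⟧ N ρ w
  pin-holds X≐d w = ((◇⁵-universal d w d∈X , ◇⁵-universal c₂ w far-c₂) , no-xor) , no-probe
    where
    open DepthSemantics {N} {ρ} X≐d
    d∈X : X d
    d∈X = from (X≐d d) refl
    far-c₂ : ¬ ◇^ N 4 X c₂
    far-c₂ h = 1+n≰n (to (within⇔ 4 c₂) h)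
    no-xor : ¬ ⟦ somewhereₜ (x₀ ⊕ₜ farₜ (farₜ x₀)) ⟧ N ρ w
    no-xor h with ◇^⇒Reach 5 h
    ... | z , inj₁ (z∈X , not-near-far) , _ with to (X≐d z) z∈X
    ...   | refl = not-near-far λ h′ → let (y , far-y , reach) = ◇^⇒Reach 4 h′ in
                     far-y (Reach⇒◇^ 4 (Reach-sym 4 reach) d∈X)
    no-xor h | z , inj₂ (¬z∈X , not-near-far) , _ with within4-or-far c₂ z
    ... | inj₁ reach = not-near-far (Reach⇒◇^ 4 reach far-c₂)
    ... | inj₂ (inj₂ (_ , refl)) = ¬z∈X d∈X
    no-probe : ¬ ⟦ somewhereₜ probeₜ ⟧ N ρ w
    no-probe h with ◇^⇒Reach 5 h
    ... | z , (s₂ , no-s₃) , _ with depth≡3 z (to (sphere⇔ 2 z) s₂)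
    ... | refl = no-s₃ (step (fwd ab₂) (from (sphere⇔ 3 b₂) refl))

-- The separating equations

separatorₜ : ℕ → Tm
separatorₜ r = pinₜ ∧ₜ ¬ₜ (has-dead-endₜ r)

module Separation (em : ExcludedMiddle 0ℓ) where
  open Equivalence using (to; from)

  mem? : (A : SubsetE) → ∀ i → Dec (mem A i)
  mem? A i = em

  start : SubsetE → ℕ → ℕ
  start A = ChainDistance.start A (mem? A)

  separator-valid : ∀ {A k} → mem A (ev k) → Valid A (separatorₜ (start A k)) 𝟎
  separator-valid {A} {k} m σ w = mk⇔ (λ (pinned , no-dead-end) → no-dead-end (dead-end pinned)) λ ()
    where
    ρ : ℕ → Sub
    ρ = valD A σ
    dead-end : ⟦ pinₜ ⟧ A ρ w → ⟦ has-dead-endₜ (start A k) ⟧ A ρ w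
    dead-end pinned =
      from (ChainSemantics.has-dead-end⇔ A (mem? A) (Pin.pin {A} {ρ} em pinned) (start A k) w)
           (_ , ChainDistance.ℓ-odd-dead-end A (mem? A) {k} m)

  separator-invalid : ∀ {B k} → ¬ mem B (ev k) → ¬ Valid B (separatorₜ (start B k)) 𝟎
  separator-invalid {B} {k} ∉ valid = to (valid (λ _ → x₀) d) (Pin.pin-holds {B} {ρ} x≐d d , no-dead-end)
    where
    ρ : ℕ → Sub
    ρ = valD B (λ _ → x₀)
    x≐d : ρ 0 ≐ singleton-d
    x≐d _ = ⇔-refl
    no-dead-end : ¬ ⟦ has-dead-endₜ (start B k) ⟧ B ρ d
    no-dead-end h = ChainDistance.no-dead-end B (mem? B) ∉
                      (proj₂ (to (ChainSemantics.has-dead-end⇔ B (mem? B) x≐d (start B k) d) h))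

  mem-transfer : ∀ {A B} → SameVariety A B → ∀ k → (∀ {j} → j < k → mem A (ev j) ⇔ mem B (ev j)) →
                 mem A (ev k) → mem B (ev k)
  mem-transfer {A} {B} same k below m with em {mem B (ev k)}
  ... | yes m′ = m′
  ... | no ∉ = ⊥-elim (separator-invalid ∉ valid-in-B)
    where
    valid-in-B : Valid B (separatorₜ (start B k)) 𝟎
    valid-in-B = subst (λ r → Valid B (separatorₜ r) 𝟎) (start-agree (mem? A) (mem? B) k below)
                       (to (same (separatorₜ (start A k)) 𝟎) (separator-valid {A} m))

  agree-ev : ∀ {M N} → SameVariety M N → ∀ k → mem M (ev k) ⇔ mem N (ev k)
  agree-ev {M} {N} same = <-rec (λ k → mem M (ev k) ⇔ mem N (ev k)) λ k below →
    mk⇔ (mem-transfer same k below)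
        (mem-transfer {N} {M} (λ s t → ⇔-sym (same s t)) k (λ j<k → ⇔-sym (below j<k)))

lemma3p16 : ExcludedMiddle 0ℓ → (M N : SubsetE) → ¬ SameSubset M N → ¬ SameVariety M N
lemma3p16 em M N M≠N same = M≠N (SameSubset-from-ev {M} {N} (agree-ev {M} {N} same))
  where open Separation em
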